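{- For every $n\ge 3$, the set $\Phi(I_n)$ is in bijection with the set $\mathcal{L}([n-2])$.
   Context: Let $[n]=\{1,\ldots,n\}$. The poset $F_{n,2}$ has ground set $\emptyset$ together with all subsets of $[n]$ of size 1 or 2; identifying a nonempty such set $S$ with $(a,b)$, where $a=\max S$ and $b$ is the other element (or $b=0$ if $|S|=1$), the order is: $\emptyset$ is minimum and $(a,b)\preceq(c,d)$ iff $a\le c$ and $b\le d$. For $n\ge 3$ let $I_n=\{\{j,i\}: 1\le i<j<n\}$ (the doubletons not comparable in $F_{n,2}$ with the singleton $\{n\}$). Let $\Phi(I_n)$ be the set of partial orders $P$ on $I_n\cup\{\{n\}\}$ such that $P$ contains the order induced by $F_{n,2}$ on this set, $\{n\}$ is comparable in $P$ with every element of $I_n$, and $P$ is minimal under inclusion of order relations with these two properties. For $k\ge 1$, $\mathcal{L}([k])$ is the set of $k$-tuples $(0,\ldots,0,s_1,s_2,\ldots,s_j)$ with $k-j$ leading zeros, where $0\le j\le k$ and $1\le s_1<s_2<\cdots<s_j\le k$ (equivalently, the list of elements of a subset $S\subseteq[k]$ in increasing order preceded by $k-|S|$ zeros). -}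

module Defs where

open import Data.Nat using (ℕ; zero; suc; _≤_; _<_)
open import Data.Bool using (Bool; true; false)
open import Data.Product using (Σ; _×_; _,_)
open import Data.Sum using (_⊎_)
open import Data.List using (List; replicate; _++_)
open import Data.List.Relation.Unary.All using (All)
open import Data.List.Relation.Unary.Linked using (Linked)
open import Data.Vec using (Vec; toList)
open import Relation.Binary.PropositionalEquality using (_≡_)

-- The poset F_{n,2}: a nonempty set S (|S| ≤ 2) is identified with the
-- pair (a , b), a = max S, b = the other element (0 if |S| = 1).
-- (a , b) ⪯ (c , d)  iff  a ≤ c and b ≤ d.  (∅ is the minimum; it does
-- not occur in I_n ∪ {{n}}, so it is not needed below.)

_⪯F_ : ℕ × ℕ → ℕ × ℕ → Set
(a , b) ⪯F (c , d) = (a ≤ c) × (b ≤ d)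

-- The ground set I_n ∪ {{n}}:
--   sing       is the singleton {n}, i.e. the pair (n , 0)
--   dbl j i …  is the doubleton {j , i} with 1 ≤ i < j < n, i.e. (j , i)

data Elt (n : ℕ) : Set where
  sing : Elt n
  dbl  : (j i : ℕ) → 1 ≤ i → i < j → j < n → Elt n

coord : ∀ {n} → Elt n → ℕ × ℕ
coord {n} sing = n , 0
coord (dbl j i _ _ _) = j , i

BRel : ℕ → Set
BRel n = Elt n → Elt n → Bool

_≐_ : ∀ {n} → BRel n → BRel n → Set
R ≐ Q = ∀ x y → R x y ≡ Q x y

_⊆R_ : ∀ {n} → BRel n → BRel n → Set
Q ⊆R R = ∀ x y → Q x y ≡ true → R x y ≡ true

IsPartialOrder : ∀ {n} → BRel n → Set
IsPartialOrder R =
  (∀ x → R x x ≡ true) ×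
  (∀ x y → R x y ≡ true → R y x ≡ true → x ≡ y) ×
  (∀ x y z → R x y ≡ true → R y z ≡ true → R x z ≡ true)

ContainsInduced : ∀ {n} → BRel n → Set
ContainsInduced R = ∀ x y → coord x ⪯F coord y → R x y ≡ true

SingComparable : ∀ {n} → BRel n → Set
SingComparable R = ∀ x → (R sing x ≡ true) ⊎ (R x sing ≡ true)

Admissible : ∀ {n} → BRel n → Set
Admissible R = IsPartialOrder R × ContainsInduced R × SingComparable R

InΦ : ∀ {n} → BRel n → Set
InΦ R = Admissible R × (∀ Q → Admissible Q → Q ⊆R R → Q ≐ R)

InL : (k : ℕ) → Vec ℕ k → Set
InL k v = Σ ℕ λ z → Σ (List ℕ) λ s →
  Linked _<_ s × All (λ x → (1 ≤ x) × (x ≤ k)) s × (toList v ≡ replicate z 0 ++ s)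

-- A minimal admissible order P is determined by D = {x ∈ I_n | x ≤_P {n}}, a downset of
-- (I_n, ⪯): P is the order obtained from ⪯ by inserting {n} between D and its complement,
-- and for every downset D this order is admissible and minimal. In the coordinates
-- (t, i) = (j − i, i) of the doubleton {j, i}, a downset of I_n is a staircase whose
-- column heights h(1) ≥ h(2) ≥ ⋯ drop by at most one at each step and vanish beyond
-- n − 2. The set S of columns at which the height drops determines it,
-- h(t) = #{s ∈ S | s ≥ t}, so downsets correspond to subsets S ⊆ [n − 2], that is, to
-- the tuples of L([n − 2]).
module Submission where

open import Defs
open import Data.Nat using (ℕ; zero; suc; _+_; _∸_; _≤_; _<_; z≤n; s≤s; s≤s⁻¹)
open import Data.Nat.Properties
open import Data.Bool using (Bool; true; false; not; _∧_; _∨_)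
open import Data.Bool.Properties using (¬-not; ∨-zeroʳ)
open import Data.Product using (Σ; _×_; _,_; proj₁; proj₂)
open import Data.Product.Properties using (,-injectiveˡ; ,-injectiveʳ)
open import Data.Sum using (_⊎_; inj₁; inj₂)
open import Data.List using (List; []; _∷_; length; map; replicate; _++_)
open import Data.List.Properties using (length-++; length-replicate)
open import Data.List.Relation.Unary.All as All using (All; []; _∷_)
import Data.List.Relation.Unary.All.Properties as All
open import Data.List.Relation.Unary.AllPairs as AllPairs using (AllPairs; []; _∷_)
import Data.List.Relation.Unary.AllPairs.Properties as AllPairs
open import Data.List.Relation.Unary.Linked.Properties using (AllPairs⇒Linked; Linked⇒AllPairs)
open import Data.Vec using (Vec; toList; fromList; cast)
open import Data.Vec.Properties
  using (toList-injective; toList-cast; toList∘fromList; length-toList; cast-is-id)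
open import Relation.Nullary using (Dec; yes; no; does; contradiction)
open import Relation.Nullary.Decidable using (dec-true; dec-false; _×-dec_)
open import Relation.Binary.Definitions using (tri<; tri≈; tri>)
open import Relation.Binary.PropositionalEquality

dec-true⁻¹ : ∀ {p} {P : Set p} (P? : Dec P) → does P? ≡ true → P
dec-true⁻¹ (yes p) _ = p

Bool-ext : ∀ {a b} → (a ≡ true → b ≡ true) → (b ≡ true → a ≡ true) → a ≡ b
Bool-ext {true}  a⇒b _   = sym (a⇒b refl)
Bool-ext {false} {true}  _ b⇒a = b⇒a refl
Bool-ext {false} {false} _ _   = refl

count≥ : ℕ → List ℕ → ℕ
count≥ t [] = 0
count≥ t (x ∷ xs) with t ≤? x
... | yes _ = suc (count≥ t xs)
... | no  _ = count≥ t xs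

module _ {t : ℕ} where
  count≥-≤-length : ∀ xs → count≥ t xs ≤ length xs
  count≥-≤-length [] = z≤n
  count≥-≤-length (x ∷ xs) with t ≤? x
  ... | yes _ = s≤s (count≥-≤-length xs)
  ... | no  _ = m≤n⇒m≤1+n (count≥-≤-length xs)

  count≥-all : ∀ {xs} → All (t ≤_) xs → count≥ t xs ≡ length xs
  count≥-all [] = refl
  count≥-all {x ∷ _} (t≤x ∷ t≤xs) with t ≤? x
  ... | yes _   = cong suc (count≥-all t≤xs)
  ... | no  t≰x = contradiction t≤x t≰x

  count≥-none : ∀ {xs} → All (_< t) xs → count≥ t xs ≡ 0
  count≥-none [] = refl
  count≥-none {x ∷ _} (x<t ∷ xs<t) with t ≤? x
  ... | yes t≤x = contradiction t≤x (<⇒≱ x<t)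
  ... | no  _   = count≥-none xs<t

  count≥-∷-cancel : ∀ x xs ys → count≥ t (x ∷ xs) ≡ count≥ t (x ∷ ys) → count≥ t xs ≡ count≥ t ys
  count≥-∷-cancel x xs ys eq with t ≤? x
  ... | yes _ = suc-injective eq
  ... | no  _ = eq

count≥-antitone : ∀ {t t'} → t ≤ t' → ∀ xs → count≥ t' xs ≤ count≥ t xs
count≥-antitone t≤t' [] = z≤n
count≥-antitone {t} {t'} t≤t' (x ∷ xs) with t' ≤? x | t ≤? x
... | yes _    | yes _   = s≤s (count≥-antitone t≤t' xs)
... | yes t'≤x | no t≰x  = contradiction (≤-trans t≤t' t'≤x) t≰x
... | no _     | yes _   = m≤n⇒m≤1+n (count≥-antitone t≤t' xs)
... | no _     | no _    = count≥-antitone t≤t' xs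

count≥-map-suc : ∀ t xs → count≥ (suc t) (map suc xs) ≡ count≥ t xs
count≥-map-suc t [] = refl
count≥-map-suc t (x ∷ xs) with suc t ≤? suc x | t ≤? x
... | yes _       | yes _   = cong suc (count≥-map-suc t xs)
... | yes 1+t≤1+x | no t≰x  = contradiction (s≤s⁻¹ 1+t≤1+x) t≰x
... | no 1+t≰1+x  | yes t≤x = contradiction (s≤s t≤x) 1+t≰1+x
... | no _        | no _    = count≥-map-suc t xs

-- In a strictly increasing list each value occurs at most once.
count≥-suc : ∀ {t xs} → AllPairs _<_ xs → count≥ t xs ≤ suc (count≥ (suc t) xs)
count≥-suc [] = z≤n
count≥-suc {t} {x ∷ xs} (x<xs ∷ xs↑) with t ≤? x | suc t ≤? x
... | yes _   | yes _   = s≤s (count≥-suc xs↑)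
... | yes t≤x | no _    = s≤s (≤-reflexive (trans
      (count≥-all (All.map (λ x<y → ≤-trans t≤x (<⇒≤ x<y)) x<xs))
      (sym (count≥-all (All.map (≤-trans (s≤s t≤x)) x<xs)))))
... | no t≰x  | yes t<x = contradiction (<⇒≤ t<x) t≰x
... | no _    | no _    = count≥-suc xs↑

count≥-shift : ∀ {t xs} → AllPairs _<_ xs → ∀ m → count≥ t xs ≤ m + count≥ (m + t) xs
count≥-shift xs↑ zero = ≤-refl
count≥-shift {t} {xs} xs↑ (suc m) = begin
  count≥ t xs                              ≤⟨ count≥-shift xs↑ m ⟩
  m + count≥ (m + t) xs                    ≤⟨ +-monoʳ-≤ m (count≥-suc xs↑) ⟩
  m + suc (count≥ (suc m + t) xs)          ≡⟨ +-suc m _ ⟩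
  suc m + count≥ (suc m + t) xs            ∎
  where open ≤-Reasoning

count≥-shift-∸ : ∀ {xs} → AllPairs _<_ xs → ∀ t t' → count≥ t xs ≤ (t' ∸ t) + count≥ t' xs
count≥-shift-∸ {xs} xs↑ t t' with ≤-total t' t
... | inj₁ t'≤t rewrite m≤n⇒m∸n≡0 t'≤t = count≥-antitone t'≤t xs
... | inj₂ t≤t' =
  subst (λ u → count≥ t xs ≤ (t' ∸ t) + count≥ u xs) (m∸n+n≡m t≤t') (count≥-shift xs↑ (t' ∸ t))

count≥-bounded : ∀ {k t xs} → AllPairs _<_ xs → All (_≤ k) xs → count≥ t xs ≤ suc k ∸ t
count≥-bounded {k} {t} {xs} xs↑ xs≤k = begin
  count≥ t xs                      ≤⟨ count≥-shift-∸ xs↑ t (suc k) ⟩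
  (suc k ∸ t) + count≥ (suc k) xs  ≡⟨ cong ((suc k ∸ t) +_) (count≥-none (All.map s≤s xs≤k)) ⟩
  (suc k ∸ t) + 0                  ≡⟨ +-identityʳ _ ⟩
  suc k ∸ t                        ∎
  where open ≤-Reasoning

count≥-∷⇒head-≤ : ∀ {x y xs ys} → All (y <_) ys → length xs ≤ length ys →
  count≥ y (y ∷ ys) ≤ count≥ y (x ∷ xs) → y ≤ x
count≥-∷⇒head-≤ {x} {y} {xs} {ys} y<ys |xs|≤|ys| le with y ≤? x
... | yes y≤x = y≤x
... | no  _   = contradiction le (<⇒≱ (begin-strict
  count≥ y xs        ≤⟨ count≥-≤-length xs ⟩
  length xs          ≤⟨ |xs|≤|ys| ⟩
  length ys          <⟨ ≤-refl ⟩
  suc (length ys)    ≡⟨ count≥-all (≤-refl ∷ All.map <⇒≤ y<ys) ⟨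
  count≥ y (y ∷ ys)  ∎))
  where open ≤-Reasoning

count≥-injective : ∀ {xs ys} → AllPairs _<_ xs → AllPairs _<_ ys → All (1 ≤_) xs → All (1 ≤_) ys →
  (∀ {t} → 1 ≤ t → count≥ t xs ≡ count≥ t ys) → xs ≡ ys
count≥-injective [] [] _ _ _ = refl
count≥-injective [] (_ ∷ _) _ 1≤ys eq with () ← trans (eq ≤-refl) (count≥-all 1≤ys)
count≥-injective (_ ∷ _) [] 1≤xs _ eq with () ← trans (sym (eq ≤-refl)) (count≥-all 1≤xs)
count≥-injective {x ∷ xs} {y ∷ ys} (x<xs ∷ xs↑) (y<ys ∷ ys↑)
                 1≤x∷xs@(1≤x ∷ 1≤xs) 1≤y∷ys@(1≤y ∷ 1≤ys) eq =
  cong₂ _∷_ x≡y (count≥-injective xs↑ ys↑ 1≤xs 1≤ys λ {t} 1≤t →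
    count≥-∷-cancel y xs ys (subst (λ z → count≥ t (z ∷ xs) ≡ count≥ t (y ∷ ys)) x≡y (eq 1≤t)))
  where
  |xs|≡|ys| : length xs ≡ length ys
  |xs|≡|ys| = suc-injective
    (trans (sym (count≥-all 1≤x∷xs)) (trans (eq ≤-refl) (count≥-all 1≤y∷ys)))
  x≡y : x ≡ y
  x≡y = ≤-antisym (count≥-∷⇒head-≤ x<xs (≤-reflexive (sym |xs|≡|ys|)) (≤-reflexive (eq 1≤x)))
                  (count≥-∷⇒head-≤ y<ys (≤-reflexive |xs|≡|ys|) (≤-reflexive (sym (eq 1≤y))))

≤?-threshold-unique : ∀ {a b c} → a ≤ c → b ≤ c →
  (∀ {i} → 1 ≤ i → i ≤ c → does (i ≤? a) ≡ does (i ≤? b)) → a ≡ b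
≤?-threshold-unique a≤c b≤c agree =
  ≤-antisym (half a≤c agree) (half b≤c (λ 1≤i i≤c → sym (agree 1≤i i≤c)))
  where
  half : ∀ {a b c} → a ≤ c → (∀ {i} → 1 ≤ i → i ≤ c → does (i ≤? a) ≡ does (i ≤? b)) → a ≤ b
  half {zero} _ _ = z≤n
  half {suc a} {b} a≤c agree =
    dec-true⁻¹ (suc a ≤? b) (trans (sym (agree (s≤s z≤n) a≤c)) (dec-true (suc a ≤? suc a) ≤-refl))

0<m≤o∸n⇒n+m≤o : ∀ {t i c} → 1 ≤ i → i ≤ c ∸ t → t + i ≤ c
0<m≤o∸n⇒n+m≤o {t} {i} {c} 1≤i i≤c∸t = subst (_≤ c) (+-comm i t) (m≤o∸n⇒m+n≤o i t≤c i≤c∸t)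
  where
  t≤c : t ≤ c
  t≤c = <⇒≤ (m∸n≢0⇒n<m λ c∸t≡0 → <⇒≱ 1≤i (subst (i ≤_) c∸t≡0 i≤c∸t))

IsSubsetList : ℕ → List ℕ → Set
IsSubsetList k s = AllPairs _<_ s × All (λ x → 1 ≤ x × x ≤ k) s

-- Coordinates (t, i) = (j − i, i) of the doubleton {j, i}: column t has height #{x ∈ s | x ≥ t}.
stair : List ℕ → ℕ → ℕ → Bool
stair s t i = does (i ≤? count≥ t s)

stair-down : ∀ {s} → AllPairs _<_ s → ∀ {t i t' i'} → i' ≤ i → t' + i' ≤ t + i →
  stair s t i ≡ true → stair s t' i' ≡ true
stair-down {s} s↑ {t} {i} {t'} {i'} i'≤i t'+i'≤t+i i≤count =
  dec-true (i' ≤? count≥ t' s) (+-cancelʳ-≤ (t' ∸ t) i' (count≥ t' s) (begin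
    i' + (t' ∸ t)            ≤⟨ +-monoʳ-≤ i' (m≤n+o⇒m∸n≤o t' t t'≤t+[i∸i']) ⟩
    i' + (i ∸ i')            ≡⟨ m+[n∸m]≡n i'≤i ⟩
    i                        ≤⟨ dec-true⁻¹ (i ≤? count≥ t s) i≤count ⟩
    count≥ t s               ≤⟨ count≥-shift-∸ s↑ t t' ⟩
    (t' ∸ t) + count≥ t' s   ≡⟨ +-comm (t' ∸ t) _ ⟩
    count≥ t' s + (t' ∸ t)   ∎))
  where
  open ≤-Reasoning
  t'≤t+[i∸i'] : t' ≤ t + (i ∸ i')
  t'≤t+[i∸i'] = +-cancelʳ-≤ i' t' (t + (i ∸ i')) (begin
    t' + i'            ≤⟨ t'+i'≤t+i ⟩
    t + i              ≡⟨ cong (t +_) (m∸n+n≡m i'≤i) ⟨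
    t + (i ∸ i' + i')  ≡⟨ +-assoc t (i ∸ i') i' ⟨
    t + (i ∸ i') + i'  ∎)

stair-injective : ∀ {k s s'} → IsSubsetList k s → IsSubsetList k s' →
  (∀ {t i} → 1 ≤ t → 1 ≤ i → t + i ≤ suc k → stair s t i ≡ stair s' t i) → s ≡ s'
stair-injective (s↑ , s⊆) (s'↑ , s'⊆) agree =
  count≥-injective s↑ s'↑ (All.map proj₁ s⊆) (All.map proj₁ s'⊆) λ 1≤t →
    ≤?-threshold-unique (count≥-bounded s↑ (All.map proj₂ s⊆))
                        (count≥-bounded s'↑ (All.map proj₂ s'⊆))
                        λ 1≤i i≤1+k∸t → agree 1≤t 1≤i (0<m≤o∸n⇒n+m≤o 1≤i i≤1+k∸t)

-- A downset of I_{k+2} in these coordinates; closure under the two covering moves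
-- {j, i} ↦ {j − 1, i} (leftward) and {j, i} ↦ {j, i − 1} (diagonal) suffices.
record IsStaircase (k : ℕ) (D : ℕ → ℕ → Bool) : Set where
  field
    bounded  : ∀ {t i} → 1 ≤ t → 1 ≤ i → D t i ≡ true → t + i ≤ suc k
    leftward : ∀ {t i} → 1 ≤ t → D (suc t) i ≡ true → D t i ≡ true
    diagonal : ∀ {t i} → 1 ≤ i → D t (suc i) ≡ true → D (suc t) i ≡ true

shift-isStaircase : ∀ {k D} → IsStaircase (suc k) D → IsStaircase k (λ t → D (suc t))
shift-isStaircase D-stair = record
  { bounded  = λ 1≤t 1≤i e → s≤s⁻¹ (bounded (s≤s z≤n) 1≤i e)
  ; leftward = λ 1≤t → leftward (s≤s z≤n)
  ; diagonal = diagonal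
  }
  where open IsStaircase D-stair

addColumn : Bool → List ℕ → List ℕ
addColumn true  s = 1 ∷ map suc s
addColumn false s = map suc s

map-suc-isSubsetList : ∀ {k s} → IsSubsetList k s → IsSubsetList (suc k) (map suc s)
map-suc-isSubsetList (s↑ , s⊆) =
  AllPairs.map⁺ (AllPairs.map s≤s s↑) , All.map⁺ (All.map (λ (_ , x≤k) → s≤s z≤n , s≤s x≤k) s⊆)

addColumn-isSubsetList : ∀ {k s} b → IsSubsetList k s → IsSubsetList (suc k) (addColumn b s)
addColumn-isSubsetList true  s-sub@(_ , s⊆) =
  All.map⁺ (All.map (λ (1≤x , _) → s≤s 1≤x) s⊆) ∷ proj₁ (map-suc-isSubsetList s-sub) ,
  (≤-refl , s≤s z≤n) ∷ proj₂ (map-suc-isSubsetList s-sub)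
addColumn-isSubsetList false s-sub = map-suc-isSubsetList s-sub

count≥-addColumn : ∀ b s {t} → 1 ≤ t → count≥ (suc t) (addColumn b s) ≡ count≥ t s
count≥-addColumn true  s {suc t} _ = count≥-map-suc (suc t) s
count≥-addColumn false s {t}     _ = count≥-map-suc t s

addColumn-height : ∀ b s → let c = count≥ 1 (addColumn b s) in
  length s ≤ c × c ≤ suc (length s) × b ≡ does (suc (length s) ≤? c)
addColumn-height true  s rewrite count≥-map-suc 0 s | count≥-all (All.universal (λ _ → z≤n) s) =
  n≤1+n _ , ≤-refl , sym (dec-true (suc (length s) ≤? suc (length s)) ≤-refl)
addColumn-height false s rewrite count≥-map-suc 0 s | count≥-all (All.universal (λ _ → z≤n) s) =
  ≤-refl , n≤1+n _ , sym (dec-false (suc (length s) ≤? length s) 1+n≰n)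

indicator : ∀ {f : ℕ → Bool} {a c} → a ≤ c → c ≤ suc a → f (suc a) ≡ does (suc a ≤? c) →
  (∀ {i} → 1 ≤ i → i ≤ a → f i ≡ true) → (∀ {i} → suc a < i → f i ≡ false) →
  ∀ {i} → 1 ≤ i → f i ≡ does (i ≤? c)
indicator {a = a} {c} a≤c c≤1+a f[1+a] initial final {i} 1≤i with <-cmp i (suc a)
... | tri< i<1+a _ _ =
  trans (initial 1≤i (s≤s⁻¹ i<1+a)) (sym (dec-true (i ≤? c) (≤-trans (s≤s⁻¹ i<1+a) a≤c)))
... | tri≈ _ refl _  = f[1+a]
... | tri> _ _ 1+a<i =
  trans (final 1+a<i) (sym (dec-false (i ≤? c) (<⇒≱ (≤-<-trans c≤1+a 1+a<i))))

-- Without column 1 a staircase is one for k − 1; column 1 is at most one cell taller than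
-- column 2, and 1 ∈ s exactly when it is taller.
staircase⇒stair : ∀ k {D} → IsStaircase k D →
  Σ (List ℕ) λ s → IsSubsetList k s × (∀ {t i} → 1 ≤ t → 1 ≤ i → D t i ≡ stair s t i)
staircase⇒stair zero D-stair = [] , ([] , []) , λ 1≤t 1≤i →
  trans (¬-not λ Dti → <⇒≱ (+-mono-≤ 1≤t 1≤i) (bounded 1≤t 1≤i Dti))
        (sym (dec-false (_ ≤? 0) (<⇒≱ 1≤i)))
  where open IsStaircase D-stair
staircase⇒stair (suc k) {D} D-stair with staircase⇒stair k (shift-isStaircase D-stair)
... | s' , s'-sub , agree' = s , addColumn-isSubsetList (D 1 (suc a)) s'-sub , agree
  where
  open IsStaircase D-stair
  a = length s'
  s = addColumn (D 1 (suc a)) s'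

  column₂ : ∀ {i} → 1 ≤ i → D 2 i ≡ does (i ≤? a)
  column₂ {i} 1≤i =
    trans (agree' ≤-refl 1≤i)
          (cong (λ c → does (i ≤? c)) (count≥-all (All.map proj₁ (proj₂ s'-sub))))

  column₁ : ∀ {i} → 1 ≤ i → D 1 i ≡ stair s 1 i
  column₁ = indicator (proj₁ height) (proj₁ (proj₂ height)) (proj₂ (proj₂ height)) within beyond
    where
    height = addColumn-height (D 1 (suc a)) s'
    within : ∀ {i} → 1 ≤ i → i ≤ a → D 1 i ≡ true
    within 1≤i i≤a = leftward ≤-refl (trans (column₂ 1≤i) (dec-true (_ ≤? a) i≤a))
    beyond : ∀ {i} → suc a < i → D 1 i ≡ false
    beyond {suc i} 1+a<1+i = ¬-not λ D1[1+i] →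
      <⇒≱ a<i (dec-true⁻¹ (i ≤? a) (trans (sym (column₂ 1≤i)) (diagonal 1≤i D1[1+i])))
      where
      a<i = s≤s⁻¹ 1+a<1+i
      1≤i = ≤-trans (s≤s z≤n) a<i

  agree : ∀ {t i} → 1 ≤ t → 1 ≤ i → D t i ≡ stair s t i
  agree {suc zero}    _ 1≤i = column₁ 1≤i
  agree {suc (suc t)} {i} _ 1≤i =
    trans (agree' (s≤s z≤n) 1≤i)
          (cong (λ c → does (i ≤? c)) (sym (count≥-addColumn (D 1 (suc a)) s' (s≤s z≤n))))

_⪯F?_ : ∀ p q → Dec (p ⪯F q)
(a , b) ⪯F? (c , d) = (a ≤? c) ×-dec (b ≤? d)

⪯F-refl : ∀ {p} → p ⪯F p
⪯F-refl = ≤-refl , ≤-refl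

⪯F-trans : ∀ {p q r} → p ⪯F q → q ⪯F r → p ⪯F r
⪯F-trans (a≤c , b≤d) (c≤e , d≤f) = ≤-trans a≤c c≤e , ≤-trans b≤d d≤f

⪯F-antisym : ∀ {p q} → p ⪯F q → q ⪯F p → p ≡ q
⪯F-antisym (a≤c , b≤d) (c≤a , d≤b) = cong₂ _,_ (≤-antisym a≤c c≤a) (≤-antisym b≤d d≤b)

module _ {n : ℕ} where

  coord-injective : ∀ {x y : Elt n} → coord x ≡ coord y → x ≡ y
  coord-injective {sing} {sing} _ = refl
  coord-injective {sing} {dbl _ _ 1≤i _ _} eq = contradiction (,-injectiveʳ eq) (<⇒≢ 1≤i)
  coord-injective {dbl _ _ 1≤i _ _} {sing} eq = contradiction (sym (,-injectiveʳ eq)) (<⇒≢ 1≤i)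
  coord-injective {dbl j i 1≤i i<j j<n} {dbl j' i' 1≤i' i'<j' j'<n} eq
    with refl ← ,-injectiveˡ eq | refl ← ,-injectiveʳ eq
    rewrite ≤-irrelevant 1≤i 1≤i' | ≤-irrelevant i<j i'<j' | ≤-irrelevant j<n j'<n = refl

  sing-isolatedˡ : ∀ (y : Elt n) → coord (sing {n}) ⪯F coord y → y ≡ sing
  sing-isolatedˡ sing _ = refl
  sing-isolatedˡ (dbl _ _ _ _ j<n) (n≤j , _) = contradiction n≤j (<⇒≱ j<n)

  sing-isolatedʳ : ∀ (x : Elt n) → coord x ⪯F coord (sing {n}) → x ≡ sing
  sing-isolatedʳ sing _ = refl
  sing-isolatedʳ (dbl _ _ 1≤i _ _) (_ , i≤0) = contradiction i≤0 (<⇒≱ 1≤i)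

  IsDown : (Elt n → Bool) → Set
  IsDown d = ∀ x y → coord x ⪯F coord y → d y ≡ true → d x ≡ true

  lower upper : (Elt n → Bool) → Elt n → Bool
  lower d sing = true
  lower d x@(dbl _ _ _ _ _) = d x
  upper d sing = true
  upper d x@(dbl _ _ _ _ _) = not (d x)

  Rel : (Elt n → Bool) → BRel n
  Rel d x y = (lower d x ∧ upper d y) ∨ does (coord x ⪯F? coord y)

  module _ {d : Elt n → Bool} where

    Rel-base : ∀ x y → coord x ⪯F coord y → Rel d x y ≡ true
    Rel-base x y x⪯y =
      trans (cong (lower d x ∧ upper d y ∨_) (dec-true (coord x ⪯F? coord y) x⪯y)) (∨-zeroʳ _)

    Rel-cut : ∀ x y → lower d x ≡ true → upper d y ≡ true → Rel d x y ≡ true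
    Rel-cut x y lx uy rewrite lx | uy = refl

    Rel-true⁻¹ : ∀ x y → Rel d x y ≡ true →
                 (lower d x ≡ true × upper d y ≡ true) ⊎ coord x ⪯F coord y
    Rel-true⁻¹ x y = split (lower d x) (upper d y) (coord x ⪯F? coord y)
      where
      split : ∀ {P : Set} a b (P? : Dec P) → a ∧ b ∨ does P? ≡ true → (a ≡ true × b ≡ true) ⊎ P
      split _     _     (yes p) _ = inj₂ p
      split true  true  (no _)  _ = inj₁ (refl , refl)
      split true  false (no _)  ()
      split false _     (no _)  ()

    lower-upper⇒sing : ∀ x → lower d x ≡ true → upper d x ≡ true → x ≡ sing
    lower-upper⇒sing sing _ _ = refl
    lower-upper⇒sing (dbl _ _ _ _ _) lx ux with () ← subst (λ b → not b ≡ true) lx ux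

    lower-upper-unique : ∀ x y → lower d x ≡ true → upper d x ≡ true →
                         lower d y ≡ true → upper d y ≡ true → x ≡ y
    lower-upper-unique x y lx ux ly uy =
      trans (lower-upper⇒sing x lx ux) (sym (lower-upper⇒sing y ly uy))

    lower-or-upper : ∀ x → lower d x ≡ true ⊎ upper d x ≡ true
    lower-or-upper sing = inj₁ refl
    lower-or-upper x@(dbl _ _ _ _ _) with d x
    ... | true  = inj₁ refl
    ... | false = inj₂ refl

    Rel-singʳ : ∀ x → Rel d x sing ≡ lower d x
    Rel-singʳ x = Bool-ext [⇒] λ lx → Rel-cut x sing lx refl
      where
      [⇒] : Rel d x sing ≡ true → lower d x ≡ true
      [⇒] xR⋆ with Rel-true⁻¹ x sing xR⋆
      ... | inj₁ (lx , _) = lx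
      ... | inj₂ x⪯⋆ = subst (λ z → lower d z ≡ true) (sym (sing-isolatedʳ x x⪯⋆)) refl

    Rel-singˡ : ∀ y → Rel d sing y ≡ upper d y
    Rel-singˡ y = Bool-ext [⇒] (Rel-cut sing y refl)
      where
      [⇒] : Rel d sing y ≡ true → upper d y ≡ true
      [⇒] ⋆Ry with Rel-true⁻¹ sing y ⋆Ry
      ... | inj₁ (_ , uy) = uy
      ... | inj₂ ⋆⪯y = subst (λ z → upper d z ≡ true) (sym (sing-isolatedˡ y ⋆⪯y)) refl

    module _ (d↓ : IsDown d) where

      lower-down : ∀ x y → coord x ⪯F coord y → lower d y ≡ true → lower d x ≡ true
      lower-down sing _ _ _ = refl
      lower-down x@(dbl _ _ _ _ _) sing x⪯⋆ _ with () ← sing-isolatedʳ x x⪯⋆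
      lower-down x@(dbl _ _ _ _ _) y@(dbl _ _ _ _ _) x⪯y ly = d↓ x y x⪯y ly

      upper-up : ∀ x y → coord x ⪯F coord y → upper d x ≡ true → upper d y ≡ true
      upper-up _ sing _ _ = refl
      upper-up sing y@(dbl _ _ _ _ _) ⋆⪯y _ with () ← sing-isolatedˡ y ⋆⪯y
      upper-up x@(dbl _ _ _ _ _) y@(dbl _ _ _ _ _) x⪯y ux with d y in dy
      ... | false = refl
      ... | true  = subst (λ b → not b ≡ true) (d↓ x y x⪯y dy) ux

      Rel-antisym : ∀ x y → Rel d x y ≡ true → Rel d y x ≡ true → x ≡ y
      Rel-antisym x y xRy yRx with Rel-true⁻¹ x y xRy | Rel-true⁻¹ y x yRx
      ... | inj₂ x⪯y       | inj₂ y⪯x       = coord-injective (⪯F-antisym x⪯y y⪯x)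
      ... | inj₁ (lx , uy) | inj₁ (ly , ux) = lower-upper-unique x y lx ux ly uy
      ... | inj₁ (lx , uy) | inj₂ y⪯x       =
        lower-upper-unique x y lx (upper-up y x y⪯x uy) (lower-down y x y⪯x lx) uy
      ... | inj₂ x⪯y       | inj₁ (ly , ux) =
        lower-upper-unique x y (lower-down x y x⪯y ly) ux ly (upper-up x y x⪯y ux)

      Rel-trans : ∀ x y z → Rel d x y ≡ true → Rel d y z ≡ true → Rel d x z ≡ true
      Rel-trans x y z xRy yRz with Rel-true⁻¹ x y xRy | Rel-true⁻¹ y z yRz
      ... | inj₂ x⪯y       | inj₂ y⪯z       = Rel-base x z (⪯F-trans x⪯y y⪯z)
      ... | inj₁ (lx , _)  | inj₁ (_ , uz)  = Rel-cut x z lx uz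
      ... | inj₁ (lx , uy) | inj₂ y⪯z       = Rel-cut x z lx (upper-up y z y⪯z uy)
      ... | inj₂ x⪯y       | inj₁ (ly , uz) = Rel-cut x z (lower-down x y x⪯y ly) uz

      Rel-admissible : Admissible (Rel d)
      Rel-admissible =
        ((λ x → Rel-base x x ⪯F-refl) , Rel-antisym , Rel-trans) , Rel-base , comparable
        where
        comparable : SingComparable (Rel d)
        comparable x with lower-or-upper x
        ... | inj₁ lx = inj₂ (Rel-cut x sing lx refl)
        ... | inj₂ ux = inj₁ (Rel-cut sing x refl ux)

      Rel-minimal : ∀ Q → Admissible Q → Q ⊆R Rel d → Q ≐ Rel d
      Rel-minimal Q ((Q-refl , _ , Q-trans) , Q-induced , Q-comparable) Q⊆Rel x y =
        Bool-ext (Q⊆Rel x y) (Rel⊆Q x y)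
        where
        Q-below : ∀ x → lower d x ≡ true → Q x sing ≡ true
        Q-below x lx with Q-comparable x
        ... | inj₂ Qx⋆ = Qx⋆
        ... | inj₁ Q⋆x = subst (λ z → Q z sing ≡ true) (sym x≡⋆) (Q-refl sing)
          where x≡⋆ = lower-upper⇒sing x lx (trans (sym (Rel-singˡ x)) (Q⊆Rel sing x Q⋆x))
        Q-above : ∀ y → upper d y ≡ true → Q sing y ≡ true
        Q-above y uy with Q-comparable y
        ... | inj₁ Q⋆y = Q⋆y
        ... | inj₂ Qy⋆ = subst (λ z → Q sing z ≡ true) (sym y≡⋆) (Q-refl sing)
          where y≡⋆ = lower-upper⇒sing y (trans (sym (Rel-singʳ y)) (Q⊆Rel y sing Qy⋆)) uy
        Rel⊆Q : Rel d ⊆R Q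
        Rel⊆Q x y xRy with Rel-true⁻¹ x y xRy
        ... | inj₁ (lx , uy) = Q-trans x sing y (Q-below x lx) (Q-above y uy)
        ... | inj₂ x⪯y       = Q-induced x y x⪯y

      Rel-inΦ : InΦ (Rel d)
      Rel-inΦ = Rel-admissible , Rel-minimal

  below : BRel n → Elt n → Bool
  below R x = R x sing

  module _ {R : BRel n} (R-adm : Admissible R) where
    private
      R-refl = proj₁ (proj₁ R-adm)
      R-trans = proj₂ (proj₂ (proj₁ R-adm))
      R-induced = proj₁ (proj₂ R-adm)
      R-comparable = proj₂ (proj₂ R-adm)

    below-isDown : IsDown (below R)
    below-isDown x y x⪯y yR⋆ = R-trans x y sing (R-induced x y x⪯y) yR⋆

    Rel-below⊆R : Rel (below R) ⊆R R
    Rel-below⊆R x y xRy with Rel-true⁻¹ x y xRy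
    ... | inj₁ (lx , uy) = R-trans x sing y (to-sing x lx) (from-sing y uy)
      where
      to-sing : ∀ x → lower (below R) x ≡ true → R x sing ≡ true
      to-sing sing _ = R-refl sing
      to-sing (dbl _ _ _ _ _) xR⋆ = xR⋆
      from-sing : ∀ y → upper (below R) y ≡ true → R sing y ≡ true
      from-sing sing _ = R-refl sing
      from-sing y@(dbl _ _ _ _ _) ¬yR⋆ with R-comparable y
      ... | inj₁ ⋆Ry = ⋆Ry
      ... | inj₂ yR⋆ with () ← subst (λ b → not b ≡ true) yR⋆ ¬yR⋆
    ... | inj₂ x⪯y = R-induced x y x⪯y

  InΦ⇒Rel-below : ∀ {R} → InΦ R → Rel (below R) ≐ R
  InΦ⇒Rel-below {R} (R-adm , R-minimal) =
    R-minimal (Rel (below R)) (Rel-admissible (below-isDown R-adm)) (Rel-below⊆R R-adm)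

  _≗ᴵ_ : (Elt n → Bool) → (Elt n → Bool) → Set
  d ≗ᴵ d' = ∀ j i 1≤i i<j j<n → d (dbl j i 1≤i i<j j<n) ≡ d' (dbl j i 1≤i i<j j<n)

  Rel-cong : ∀ {d d'} → d ≗ᴵ d' → Rel d ≐ Rel d'
  Rel-cong {d} {d'} d≗d' x y =
    cong₂ (λ a b → a ∧ b ∨ does (coord x ⪯F? coord y)) (lower-cong x) (upper-cong y)
    where
    lower-cong : ∀ x → lower d x ≡ lower d' x
    lower-cong sing = refl
    lower-cong (dbl j i 1≤i i<j j<n) = d≗d' j i 1≤i i<j j<n
    upper-cong : ∀ x → upper d x ≡ upper d' x
    upper-cong sing = refl
    upper-cong (dbl j i 1≤i i<j j<n) = cong not (d≗d' j i 1≤i i<j j<n)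

  Rel-injective : ∀ {d d'} → Rel d ≐ Rel d' → d ≗ᴵ d'
  Rel-injective {d} {d'} Rel≐ j i 1≤i i<j j<n =
    trans (sym (Rel-singʳ {d = d} x)) (trans (Rel≐ x sing) (Rel-singʳ {d = d'} x))
    where x = dbl j i 1≤i i<j j<n

  atDbl : (Elt n → Bool) → ℕ → ℕ → Bool
  atDbl d j i with 1 ≤? i | i <? j | j <? n
  ... | yes 1≤i | yes i<j | yes j<n = d (dbl j i 1≤i i<j j<n)
  ... | _       | _       | _       = false

  atDbl-dbl : ∀ d {j i} 1≤i i<j j<n → atDbl d j i ≡ d (dbl j i 1≤i i<j j<n)
  atDbl-dbl d {j} {i} 1≤i i<j j<n with 1 ≤? i | i <? j | j <? n
  ... | yes _    | yes _    | yes _    = cong d (coord-injective refl)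
  ... | no 1≰i   | _        | _        = contradiction 1≤i 1≰i
  ... | yes _    | no i≮j   | _        = contradiction i<j i≮j
  ... | yes _    | yes _    | no j≮n   = contradiction j<n j≮n

  atDbl-true⁻¹ : ∀ d j i → atDbl d j i ≡ true → 1 ≤ i × i < j × j < n
  atDbl-true⁻¹ d j i _ with 1 ≤? i | i <? j | j <? n
  atDbl-true⁻¹ d j i _  | yes 1≤i | yes i<j | yes j<n = 1≤i , i<j , j<n
  atDbl-true⁻¹ d j i () | no _    | _       | _
  atDbl-true⁻¹ d j i () | yes _   | no _    | _
  atDbl-true⁻¹ d j i () | yes _   | yes _   | no _

  atDbl-down : ∀ {d} → IsDown d → ∀ {j i j' i'} → 1 ≤ i' → i' < j' → j' ≤ j → i' ≤ i →
    atDbl d j i ≡ true → atDbl d j' i' ≡ true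
  atDbl-down {d} d↓ {j} {i} {j'} {i'} 1≤i' i'<j' j'≤j i'≤i dji with atDbl-true⁻¹ d j i dji
  ... | 1≤i , i<j , j<n = trans (atDbl-dbl d 1≤i' i'<j' j'<n)
                            (d↓ (dbl j' i' 1≤i' i'<j' j'<n) (dbl j i 1≤i i<j j<n) (j'≤j , i'≤i)
                                (trans (sym (atDbl-dbl d 1≤i i<j j<n)) dji))
    where j'<n = ≤-<-trans j'≤j j<n

  columns : (Elt n → Bool) → ℕ → ℕ → Bool
  columns d t i = atDbl d (t + i) i

  stairOn : List ℕ → Elt n → Bool
  stairOn s sing = false
  stairOn s (dbl j i _ _ _) = stair s (j ∸ i) i

  stairOn-isDown : ∀ {s} → AllPairs _<_ s → IsDown (stairOn s)
  stairOn-isDown s↑ _ sing _ ()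
  stairOn-isDown s↑ sing y@(dbl _ _ _ _ _) ⋆⪯y _ with () ← sing-isolatedˡ y ⋆⪯y
  stairOn-isDown s↑ (dbl j' i' _ i'<j' _) (dbl j i _ i<j _) (j'≤j , i'≤i) =
    stair-down s↑ i'≤i (subst₂ _≤_ (sym (m∸n+n≡m (<⇒≤ i'<j'))) (sym (m∸n+n≡m (<⇒≤ i<j))) j'≤j)

  columns≡stair⇒≗ᴵ : ∀ {d s} → (∀ {t i} → 1 ≤ t → 1 ≤ i → columns d t i ≡ stair s t i) →
                     stairOn s ≗ᴵ d
  columns≡stair⇒≗ᴵ {d} {s} agree j i 1≤i i<j j<n = begin
    stair s (j ∸ i) i          ≡⟨ agree (m<n⇒0<n∸m i<j) 1≤i ⟨
    columns d (j ∸ i) i        ≡⟨ cong (λ j' → atDbl d j' i) (m∸n+n≡m (<⇒≤ i<j)) ⟩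
    atDbl d j i                ≡⟨ atDbl-dbl d 1≤i i<j j<n ⟩
    d (dbl j i 1≤i i<j j<n)    ∎
    where open ≡-Reasoning

columns-isStaircase : ∀ {k d} → IsDown {suc (suc k)} d → IsStaircase k (columns d)
columns-isStaircase {d = d} d↓ = record
  { bounded  = λ {t} {i} _ _ e → s≤s⁻¹ (proj₂ (proj₂ (atDbl-true⁻¹ d (t + i) i e)))
  ; leftward = λ {t} {i} 1≤t e →
      atDbl-down d↓ (proj₁ (atDbl-true⁻¹ d _ i e)) (m<n+m i 1≤t) (n≤1+n (t + i)) ≤-refl e
  ; diagonal = λ {t} {i} 1≤i e →
      atDbl-down d↓ 1≤i (s≤s (m≤n+m i t)) (≤-reflexive (sym (+-suc t i))) (n≤1+n i) e
  }

stairOn-injective : ∀ {k s s'} → IsSubsetList k s → IsSubsetList k s' →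
                    stairOn {suc (suc k)} s ≗ᴵ stairOn s' → s ≡ s'
stairOn-injective {s = s} {s'} s-sub s'-sub agree =
  stair-injective s-sub s'-sub λ {t} {i} 1≤t 1≤i t+i≤1+k →
    subst (λ t' → stair s t' i ≡ stair s' t' i) (m+n∸n≡m t i)
          (agree (t + i) i 1≤i (m<n+m i 1≤t) (s≤s t+i≤1+k))

subsetOf : ∀ {k v} → InL k v → List ℕ
subsetOf (_ , s , _) = s

subsetOf-isSubsetList : ∀ {k v} (p : InL k v) → IsSubsetList k (subsetOf p)
subsetOf-isSubsetList (_ , _ , s↑ , s⊆ , _) = Linked⇒AllPairs <-trans s↑ , s⊆

InL-injective : ∀ {k} {v w : Vec ℕ k} (p : InL k v) (q : InL k w) → subsetOf p ≡ subsetOf q → v ≡ w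
InL-injective {k} {v} {w} (z , s , _ , _ , v≡) (z' , _ , _ , _ , w≡) refl =
  trans (sym (cast-is-id refl v)) (toList-injective refl v w (begin
  toList v             ≡⟨ v≡ ⟩
  replicate z 0 ++ s   ≡⟨ cong (λ m → replicate m 0 ++ s) z≡z' ⟩
  replicate z' 0 ++ s  ≡⟨ w≡ ⟨
  toList w             ∎))
  where
  open ≡-Reasoning
  padding : ∀ {u : Vec ℕ k} {m} → toList u ≡ replicate m 0 ++ s → m + length s ≡ k
  padding {u} {m} u≡ = begin
    m + length s                     ≡⟨ cong (_+ length s) (length-replicate m) ⟨
    length (replicate m 0) + length s ≡⟨ length-++ (replicate m 0) ⟨
    length (replicate m 0 ++ s)      ≡⟨ cong length u≡ ⟨
    length (toList u)                ≡⟨ length-toList u ⟩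
    k                                ∎
  z≡z' : z ≡ z'
  z≡z' = +-cancelʳ-≡ (length s) z z' (trans (padding v≡) (sym (padding w≡)))

fromSubsetList : ∀ {k s} → IsSubsetList k s → Σ (Vec ℕ k) λ v → Σ (InL k v) λ p → subsetOf p ≡ s
fromSubsetList {k} {s} (s↑ , s⊆) =
  cast |L|≡k (fromList L) ,
  (k ∸ length s , s , AllPairs⇒Linked s↑ , s⊆ ,
   trans (toList-cast |L|≡k (fromList L)) (toList∘fromList L)) ,
  refl
  where
  L = replicate (k ∸ length s) 0 ++ s
  |s|≤k : length s ≤ k
  |s|≤k = subst (_≤ k) (count≥-all (All.map proj₁ s⊆)) (count≥-bounded s↑ (All.map proj₂ s⊆))
  |L|≡k : length L ≡ k
  |L|≡k = trans (length-++ (replicate (k ∸ length s) 0))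
                (trans (cong (_+ length s) (length-replicate (k ∸ length s))) (m∸n+n≡m |s|≤k))

mainTheorem6 : (n : ℕ) → 3 ≤ n →
    Σ ((v : Vec ℕ (n ∸ 2)) → InL (n ∸ 2) v → BRel n) λ g →
      ((v : Vec ℕ (n ∸ 2)) (p : InL (n ∸ 2) v) → InΦ (g v p)) ×
      ((v w : Vec ℕ (n ∸ 2)) (p : InL (n ∸ 2) v) (q : InL (n ∸ 2) w) →
         g v p ≐ g w q → v ≡ w) ×
      ((R : BRel n) → InΦ R →
         Σ (Vec ℕ (n ∸ 2)) λ v → Σ (InL (n ∸ 2) v) λ p → g v p ≐ R)
mainTheorem6 (suc (suc k)) _ = encode , encode-inΦ , encode-injective , encode-surjective
  where
  encode : (v : Vec ℕ k) → InL k v → BRel (suc (suc k))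
  encode _ p = Rel (stairOn (subsetOf p))

  encode-inΦ : ∀ v p → InΦ (encode v p)
  encode-inΦ _ p = Rel-inΦ (stairOn-isDown (proj₁ (subsetOf-isSubsetList p)))

  encode-injective : ∀ v w p q → encode v p ≐ encode w q → v ≡ w
  encode-injective _ _ p q p≐q = InL-injective p q
    (stairOn-injective (subsetOf-isSubsetList p) (subsetOf-isSubsetList q)
      (Rel-injective p≐q))

  encode-surjective : ∀ R → InΦ R → Σ (Vec ℕ k) λ v → Σ (InL k v) λ p → encode v p ≐ R
  encode-surjective R R∈Φ with staircase⇒stair k (columns-isStaircase (below-isDown (proj₁ R∈Φ)))
  ... | s , s-sub , columns≡stair with fromSubsetList s-sub
  ...   | v , p , refl = v , p , λ x y →
    trans (Rel-cong (columns≡stair⇒≗ᴵ {d = below R} {s} columns≡stair) x y)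
          (InΦ⇒Rel-below R∈Φ x y)
mainTheorem6 (suc zero) (s≤s ())
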